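{- For all integers $m\ge2$ and $n\ge3$, the cylindrical grid graph $P_m\,\Box\,C_n$ is non-distance magic.
   Context: $P_m$ is the path on $m$ vertices, $C_n$ the cycle on $n$ vertices, and $\Box$ the Cartesian product of graphs. For a graph $G$ with $N(u)=\{v: uv\in E(G)\}$, a bijection $f:V(G)\to\{1,\dots,|V(G)|\}$ is a distance magic labeling if $\sum_{v\in N(u)}f(v)$ is the same for all $u\in V(G)$; $G$ is non-distance magic if it has no such labeling. -}

module Defs where

open import Data.Nat using (ℕ; suc; _+_; _*_)
open import Data.Nat.Properties using (_≟_)
open import Data.Fin using (Fin; toℕ)
open import Data.Fin.Properties using () renaming (_≟_ to _≟ᶠ_)
open import Data.Bool using (Bool; true; false; if_then_else_; _∧_; _∨_)
open import Data.Nat.ListAction using (sum)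
open import Data.List using (List; map; allFin; cartesianProduct)
open import Data.Product using (_×_; _,_; ∃-syntax)
open import Relation.Binary.PropositionalEquality using (_≡_)
open import Relation.Nullary using (¬_)
open import Relation.Nullary.Decidable using (⌊_⌋)
open import Function.Bundles using (Bijection; _⤖_)

record Graph : Set₁ where
  field
    V     : Set
    verts : List V                   -- enumeration of all vertices (each exactly once)
    order : ℕ
    _≟V_  : V → V → Bool
    Adj   : V → V → Bool

open Graph public

eqFin : {k : ℕ} → Fin k → Fin k → Bool
eqFin i j = ⌊ i ≟ᶠ j ⌋

pathAdj : (m : ℕ) → Fin m → Fin m → Bool
pathAdj m i j = ⌊ suc (toℕ i) ≟ toℕ j ⌋ ∨ ⌊ suc (toℕ j) ≟ toℕ i ⌋

P : ℕ → Graph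
P m = record { V = Fin m ; verts = allFin m ; order = m ; _≟V_ = eqFin ; Adj = pathAdj m }

-- Cycle C_n on vertices 0..n-1 (used for n ≥ 3): i ~ j iff j ≡ i ± 1 (mod n),
-- i.e. j = i+1, or i = j+1, or {i,j} = {0, n-1}.
cycleAdj : (n : ℕ) → Fin n → Fin n → Bool
cycleAdj n i j =
  ⌊ suc (toℕ i) ≟ toℕ j ⌋ ∨ ⌊ suc (toℕ j) ≟ toℕ i ⌋
  ∨ (⌊ toℕ i ≟ 0 ⌋ ∧ ⌊ suc (toℕ j) ≟ n ⌋)
  ∨ (⌊ toℕ j ≟ 0 ⌋ ∧ ⌊ suc (toℕ i) ≟ n ⌋)

C : ℕ → Graph
C n = record { V = Fin n ; verts = allFin n ; order = n ; _≟V_ = eqFin ; Adj = cycleAdj n }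

_□_ : Graph → Graph → Graph
G □ H = record
  { V     = V G × V H
  ; verts = cartesianProduct (verts G) (verts H)
  ; order = order G * order H
  ; _≟V_  = λ { (g , h) (g' , h') → _≟V_ G g g' ∧ _≟V_ H h h' }
  ; Adj   = λ { (g , h) (g' , h') →
               (_≟V_ G g g' ∧ Adj H h h') ∨ (_≟V_ H h h' ∧ Adj G g g') }
  }

weight : (G : Graph) → (V G → ℕ) → V G → ℕ
weight G f u = sum (map (λ v → if Adj G u v then f v else 0) (verts G))

-- A labeling is a bijection f : V(G) → {1,…,|V(G)|}; the codomain is encoded
-- as Fin |V(G)| and the label of v is 1 + toℕ (f v).
labelOf : (G : Graph) → (V G ⤖ Fin (order G)) → V G → ℕ
labelOf G f v = suc (toℕ (Bijection.to f v))

IsDistanceMagic : (G : Graph) → (V G ⤖ Fin (order G)) → Set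
IsDistanceMagic G f = ∃[ k ] (∀ u → weight G (labelOf G f) u ≡ k)

DistanceMagic : Graph → Set
DistanceMagic G = ∃[ f ] IsDistanceMagic G f

NonDistanceMagic : Graph → Set
NonDistanceMagic G = ¬ DistanceMagic G

{-# OPTIONS --safe #-}
-- Unroll the cylinder into a strip with m rows and ℕ columns, bordered by two rows of zeros. Two
-- diagonally adjacent vertices have two neighbours in common, so equal weights make the sum of the
-- labels on an antidiagonal pair of vertices invariant under a diagonal shift by two. Following
-- these shifts from the bottom border to the top one: for even m a label in row 1 equals a label in
-- row m, contradicting injectivity; for odd m two such chains show that the label at (1, 1) is at
-- least the sum of itself and the positive label at (2, 0). The hypothesis n ≥ 3 is what makes the
-- two cycle neighbours of a vertex distinct.

module Submission where

open import Data.Bool using (Bool; true; false; T; if_then_else_; _∧_; _∨_)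
open import Data.Bool.Properties using (T-∧; T-∨; ∧-comm; ⇔→≡; T-≡)
open import Data.Empty using (⊥; ⊥-elim)
open import Data.Fin using (Fin; zero; suc; toℕ; fromℕ<)
open import Data.Fin.Properties using (toℕ<n; toℕ-fromℕ<; fromℕ<-cong; toℕ-injective) renaming (_≟_ to _≟ᶠ_)
open import Data.List using (List; []; _∷_; _++_; map; allFin; cartesianProduct)
open import Data.List.Properties using (map-cong; map-++; map-∘; map-tabulate)
open import Data.Nat using (ℕ; zero; suc; pred; _+_; _<_; _≤_; _≥_; _%_; s≤s; s≤s⁻¹; z<s)
open import Data.Nat.DivMod using (m%n<n; m%n%n≡m%n; m<n⇒m%n≡m; n%n≡0; [m+n]%n≡m%n; %-distribˡ-+)
open import Data.Nat.ListAction using (sum)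
open import Data.Nat.ListAction.Properties using (sum-++)
open import Data.Nat.Properties
open import Algebra.Properties.CommutativeSemigroup +-commutativeSemigroup using (interchange)
open import Data.Nat.Tactic.RingSolver using (solve-∀)
open import Data.Product using (_×_; _,_; proj₁; proj₂; ∃-syntax)
open import Data.Product.Function.NonDependent.Propositional using (_×-⇔_)
open import Data.Sum using (_⊎_; inj₁; inj₂)
open import Data.Sum.Function.Propositional using (_⊎-⇔_)
open import Function using (_∘_; _⇔_; mk⇔; Equivalence)
open import Function.Bundles using (Bijection; _⤖_)
open import Function.Construct.Composition using (_⇔-∘_)
open import Function.Construct.Symmetry using (⇔-sym)
open import Relation.Binary.PropositionalEquality
open import Relation.Nullary using (¬_; Dec)
open import Relation.Nullary.Decidable using (⌊_⌋; toWitness; fromWitness)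

open import Defs

open Equivalence using (to; from)

T⌊⌋ : ∀ {P : Set} (d : Dec P) → T ⌊ d ⌋ ⇔ P
T⌊⌋ d = mk⇔ toWitness fromWitness

if-T : ∀ {b} x → T b → (if b then x else 0) ≡ x
if-T {true} x _ = refl

if-¬T : ∀ {b} x → ¬ T b → (if b then x else 0) ≡ 0
if-¬T {true}  x ¬b = ⊥-elim (¬b _)
if-¬T {false} x ¬b = refl

T-injective : ∀ {a b} → T a ⇔ T b → a ≡ b
T-injective a⇔b = ⇔→≡ (T-≡ ⇔-∘ (a⇔b ⇔-∘ ⇔-sym T-≡))

if-∨ : ∀ a b x → (T a → T b → ⊥) →
       (if a ∨ b then x else 0) ≡ (if a then x else 0) + (if b then x else 0)
if-∨ true  true  x disjoint = ⊥-elim (disjoint _ _)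
if-∨ true  false x disjoint = sym (+-identityʳ x)
if-∨ false b     x disjoint = refl

sum-map-cong : ∀ {A : Set} {f g : A → ℕ} → (∀ x → f x ≡ g x) → ∀ xs → sum (map f xs) ≡ sum (map g xs)
sum-map-cong f≗g xs = cong sum (map-cong f≗g xs)

sum-map-+ : ∀ {A : Set} (f g : A → ℕ) xs →
            sum (map (λ x → f x + g x) xs) ≡ sum (map f xs) + sum (map g xs)
sum-map-+ f g []       = refl
sum-map-+ f g (x ∷ xs) = trans (cong (f x + g x +_) (sum-map-+ f g xs)) (interchange (f x) (g x) _ _)

sum-map-0 : ∀ {A : Set} (xs : List A) → sum (map (λ _ → 0) xs) ≡ 0
sum-map-0 []       = refl
sum-map-0 (x ∷ xs) = sum-map-0 xs

sum-map-if-∧ : ∀ {A : Set} b (c : A → Bool) (f : A → ℕ) xs →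
               sum (map (λ x → if b ∧ c x then f x else 0) xs)
               ≡ (if b then sum (map (λ x → if c x then f x else 0) xs) else 0)
sum-map-if-∧ true  c f xs = refl
sum-map-if-∧ false c f xs = sum-map-0 xs

sum-map-cartesianProduct : ∀ {A B : Set} (F : A × B → ℕ) xs ys →
  sum (map F (cartesianProduct xs ys)) ≡ sum (map (λ x → sum (map (λ y → F (x , y)) ys)) xs)
sum-map-cartesianProduct F []       ys = refl
sum-map-cartesianProduct F (x ∷ xs) ys = begin
  sum (map F (map (x ,_) ys ++ cartesianProduct xs ys))
    ≡⟨ cong sum (map-++ F (map (x ,_) ys) _) ⟩
  sum (map F (map (x ,_) ys) ++ map F (cartesianProduct xs ys))
    ≡⟨ sum-++ (map F (map (x ,_) ys)) _ ⟩
  sum (map F (map (x ,_) ys)) + sum (map F (cartesianProduct xs ys))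
    ≡⟨ cong₂ _+_ (cong sum (sym (map-∘ ys))) (sum-map-cartesianProduct F xs ys) ⟩
  sum (map (λ y → F (x , y)) ys) + sum (map (λ x → sum (map (λ y → F (x , y)) ys)) xs) ∎
  where open ≡-Reasoning

-- Cartesian products

-- Holds when verts lists every vertex exactly once and _≟V_ decides equality.
Selective : Graph → Set
Selective G = ∀ (F : V G → ℕ) u → sum (map (λ v → if _≟V_ G u v then F v else 0) (verts G)) ≡ F u

Loopless : Graph → Set
Loopless G = ∀ u v → T (_≟V_ G u v) → ¬ T (Adj G u v)

weight-□ : ∀ G H → Selective G → Selective H → Loopless G → ∀ (f : V G × V H → ℕ) g h →
           weight (G □ H) f (g , h) ≡ weight H (λ y → f (g , y)) h + weight G (λ x → f (x , h)) g
weight-□ G H selG selH loopG f g h = begin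
  weight (G □ H) f (g , h)
    ≡⟨ sum-map-cartesianProduct _ (verts G) (verts H) ⟩
  total (λ x y → along x y ∨ across x y)
    ≡⟨ sum-map-cong (λ x → trans (sum-map-cong (λ y → if-∨ _ _ _ (disjoint x y)) (verts H))
                                  (sum-map-+ _ _ (verts H))) (verts G) ⟩
  sum (map (λ x → rowSum along x + rowSum across x) (verts G))
    ≡⟨ sum-map-+ _ _ (verts G) ⟩
  total along + total across
    ≡⟨ cong₂ _+_ along-sum across-sum ⟩
  weight H (λ y → f (g , y)) h + weight G (λ x → f (x , h)) g ∎
  where
  open ≡-Reasoning
  along across : V G → V H → Bool
  along  x y = _≟V_ G g x ∧ Adj H h y
  across x y = _≟V_ H h y ∧ Adj G g x

  disjoint : ∀ x y → T (along x y) → T (across x y) → ⊥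
  disjoint x y a c = loopG g x (proj₁ (to T-∧ a)) (proj₂ (to T-∧ c))

  rowSum : (V G → V H → Bool) → V G → ℕ
  rowSum e x = sum (map (λ y → if e x y then f (x , y) else 0) (verts H))

  total : (V G → V H → Bool) → ℕ
  total e = sum (map (rowSum e) (verts G))

  along-sum : total along ≡ weight H (λ y → f (g , y)) h
  along-sum = trans (sum-map-cong (λ x → sum-map-if-∧ (_≟V_ G g x) (Adj H h) (λ y → f (x , y)) (verts H))
                                  (verts G))
                    (selG _ g)

  across-sum : total across ≡ weight G (λ x → f (x , h)) g
  across-sum = sum-map-cong (λ x → begin
    rowSum across x
      ≡⟨ sum-map-cong (λ y → cong (λ b → if b then f (x , y) else 0) (∧-comm (_≟V_ H h y) (Adj G g x)))
                      (verts H) ⟩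
    sum (map (λ y → if Adj G g x ∧ _≟V_ H h y then f (x , y) else 0) (verts H))
      ≡⟨ sum-map-if-∧ (Adj G g x) (_≟V_ H h) (λ y → f (x , y)) (verts H) ⟩
    (if Adj G g x then sum (map (λ y → if _≟V_ H h y then f (x , y) else 0) (verts H)) else 0)
      ≡⟨ cong (λ s → if Adj G g x then s else 0) (selH (λ y → f (x , y)) h) ⟩
    (if Adj G g x then f (x , h) else 0) ∎) (verts G)

-- Paths and cycles

-- pad h is the sequence 0, h 0, h 1, …, h (k − 1), 0, 0, …; the shift by one gives vertex 0 of a
-- path a zero neighbour below it.
pad : ∀ {k} → (Fin k → ℕ) → ℕ → ℕ
pad         h zero          = 0
pad {zero}  h (suc t)       = 0
pad {suc k} h (suc zero)    = h zero
pad {suc k} h (suc (suc t)) = pad (h ∘ suc) (suc t)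

pad-fromℕ< : ∀ {k} (h : Fin k → ℕ) t .(t<k : t < k) → pad h (suc t) ≡ h (fromℕ< t<k)
pad-fromℕ< {suc k} h zero    t<k = refl
pad-fromℕ< {suc k} h (suc t) t<k = pad-fromℕ< (h ∘ suc) t (s≤s⁻¹ t<k)

pad-suc-toℕ : ∀ {k} (h : Fin k → ℕ) y → pad h (suc (toℕ y)) ≡ h y
pad-suc-toℕ h zero    = refl
pad-suc-toℕ h (suc y) = pad-suc-toℕ (h ∘ suc) y

pad-beyond : ∀ {k} (h : Fin k → ℕ) → pad h (suc k) ≡ 0
pad-beyond {zero}  h = refl
pad-beyond {suc k} h = pad-beyond (h ∘ suc)

sum-allFin-suc : ∀ {k} (g : Fin (suc k) → ℕ) →
                 sum (map g (allFin (suc k))) ≡ g zero + sum (map (g ∘ suc) (allFin k))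
sum-allFin-suc g = cong sum (trans (map-tabulate (λ y → y) g)
                                   (cong (g zero ∷_) (sym (map-tabulate (λ y → y) (g ∘ suc)))))

sum-allFin-select : ∀ {k} (A : Fin k → Bool) (h : Fin k → ℕ) t → (∀ y → T (A y) ⇔ suc (toℕ y) ≡ t) →
             sum (map (λ y → if A y then h y else 0) (allFin k)) ≡ pad h t
sum-allFin-select {zero}  A h zero    _    = refl
sum-allFin-select {zero}  A h (suc t) _    = refl
sum-allFin-select {suc k} A h t       spec = begin
  sum (map (λ y → if A y then h y else 0) (allFin (suc k)))
    ≡⟨ sum-allFin-suc (λ y → if A y then h y else 0) ⟩
  (if A zero then h zero else 0) + sum (map (λ y → if A (suc y) then h (suc y) else 0) (allFin k))
    ≡⟨ cong (_ +_) (sum-allFin-select (A ∘ suc) (h ∘ suc) (pred t) (λ y → spec-tail t ⇔-∘ spec (suc y))) ⟩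
  (if A zero then h zero else 0) + pad (h ∘ suc) (pred t)
    ≡⟨ head t (spec zero) ⟩
  pad h t ∎
  where
  open ≡-Reasoning
  spec-tail : ∀ {s} t → suc (suc s) ≡ t ⇔ suc s ≡ pred t
  spec-tail zero    = mk⇔ (λ ()) (λ ())
  spec-tail (suc t) = mk⇔ suc-injective (cong suc)

  head : ∀ t → T (A zero) ⇔ 1 ≡ t → (if A zero then h zero else 0) + pad (h ∘ suc) (pred t) ≡ pad h t
  head zero          spec₀ = trans (+-identityʳ _) (if-¬T _ (λ a → 1+n≢0 (to spec₀ a)))
  head (suc zero)    spec₀ = trans (+-identityʳ _) (if-T _ (from spec₀ refl))
  head (suc (suc t)) spec₀ = cong (_+ _) (if-¬T _ (λ a → 0≢1+n (suc-injective (to spec₀ a))))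

sum-allFin-select₂ : ∀ {k} (A : Fin k → Bool) (h : Fin k → ℕ) {a b} → a ≢ b →
              (∀ y → T (A y) ⇔ (suc (toℕ y) ≡ a ⊎ suc (toℕ y) ≡ b)) →
              sum (map (λ y → if A y then h y else 0) (allFin k)) ≡ pad h a + pad h b
sum-allFin-select₂ {k} A h {a} {b} a≢b spec = begin
  sum (map (λ y → if A y then h y else 0) (allFin k))
    ≡⟨ sum-map-cong (λ y → trans (cong (λ β → if β then h y else 0) (A≡ y)) (if-∨ _ _ _ (disjoint y)))
                    (allFin k) ⟩
  sum (map (λ y → hits a y + hits b y) (allFin k))
    ≡⟨ sum-map-+ (hits a) (hits b) (allFin k) ⟩
  sum (map (hits a) (allFin k)) + sum (map (hits b) (allFin k))
    ≡⟨ cong₂ _+_ (sum-allFin-select _ h a (T⌊⌋ ∘ is? a)) (sum-allFin-select _ h b (T⌊⌋ ∘ is? b)) ⟩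
  pad h a + pad h b ∎
  where
  open ≡-Reasoning
  is? : ∀ t (y : Fin k) → Dec (suc (toℕ y) ≡ t)
  is? t y = suc (toℕ y) ≟ t

  is : ℕ → Fin k → Bool
  is t y = ⌊ is? t y ⌋

  hits : ℕ → Fin k → ℕ
  hits t y = if is t y then h y else 0

  A≡ : ∀ y → A y ≡ is a y ∨ is b y
  A≡ y = T-injective (⇔-sym ((T⌊⌋ (is? a y) ⊎-⇔ T⌊⌋ (is? b y)) ⇔-∘ T-∨) ⇔-∘ spec y)

  disjoint : ∀ y → T (is a y) → T (is b y) → ⊥
  disjoint y p q = a≢b (trans (sym (toWitness p)) (toWitness q))

selective-allFin : ∀ {k} (F : Fin k → ℕ) u →
                   sum (map (λ v → if eqFin u v then F v else 0) (allFin k)) ≡ F u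
selective-allFin F u = trans (sum-allFin-select (eqFin u) F (suc (toℕ u)) spec) (pad-suc-toℕ F u)
  where
  spec : ∀ v → T (eqFin u v) ⇔ suc (toℕ v) ≡ suc (toℕ u)
  spec v = mk⇔ (λ u≡v → cong (suc ∘ toℕ) (sym u≡v)) (λ e → sym (toℕ-injective (suc-injective e)))
           ⇔-∘ T⌊⌋ (u ≟ᶠ v)

pathAdj-spec : ∀ {m} (i y : Fin m) → T (pathAdj m i y) ⇔ (suc (toℕ y) ≡ 2 + toℕ i ⊎ suc (toℕ y) ≡ toℕ i)
pathAdj-spec i y = (mk⇔ (cong suc ∘ sym) (sym ∘ suc-injective) ⇔-∘ T⌊⌋ (suc (toℕ i) ≟ toℕ y)
                    ⊎-⇔ T⌊⌋ (suc (toℕ y) ≟ toℕ i)) ⇔-∘ T-∨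

P-loopless : ∀ m → Loopless (P m)
P-loopless m u v u≟v adj with toWitness u≟v
... | refl with to (pathAdj-spec u u) adj
...   | inj₁ e = 1+n≢n (suc-injective (sym e))
...   | inj₂ e = 1+n≢n e

weight-P : ∀ {m} (h : Fin m → ℕ) i → weight (P m) h i ≡ pad h (2 + toℕ i) + pad h (toℕ i)
weight-P {m} h i = sum-allFin-select₂ (pathAdj m i) h (m+1+n≢n 1) (pathAdj-spec i)

column : ∀ {n₁} → ℕ → Fin (suc n₁)
column {n₁} c = fromℕ< (m%n<n c (suc n₁))

CycleStep : ℕ → ℕ → ℕ → Set
CycleStep n r s = suc r ≡ s ⊎ suc s ≡ r ⊎ (r ≡ 0 × suc s ≡ n) ⊎ (s ≡ 0 × suc r ≡ n)

T-cycleAdj : ∀ {n} (j y : Fin n) → T (cycleAdj n j y) ⇔ CycleStep n (toℕ j) (toℕ y)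
T-cycleAdj {n} j y =
  (T⌊⌋ (suc r ≟ s)
   ⊎-⇔ (T⌊⌋ (suc s ≟ r)
        ⊎-⇔ ((T⌊⌋ (r ≟ 0) ×-⇔ T⌊⌋ (suc s ≟ n)) ⇔-∘ T-∧
             ⊎-⇔ (T⌊⌋ (s ≟ 0) ×-⇔ T⌊⌋ (suc r ≟ n)) ⇔-∘ T-∧) ⇔-∘ T-∨) ⇔-∘ T-∨) ⇔-∘ T-∨
  where
  r s : ℕ
  r = toℕ j
  s = toℕ y

succ-mod-below : ∀ {n₁ r} → suc r < suc n₁ → (r + 1) % suc n₁ ≡ suc r
succ-mod-below {n₁} {r} lt = trans (cong (_% suc n₁) (+-comm r 1)) (m<n⇒m%n≡m lt)

succ-mod-top : ∀ n₁ → (n₁ + 1) % suc n₁ ≡ 0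
succ-mod-top n₁ = trans (cong (_% suc n₁) (+-comm n₁ 1)) (n%n≡0 (suc n₁))

pred-mod-zero : ∀ n₁ → n₁ % suc n₁ ≡ n₁
pred-mod-zero n₁ = m<n⇒m%n≡m (n<1+n n₁)

pred-mod-suc : ∀ {n₁ r} → r < suc n₁ → (suc r + n₁) % suc n₁ ≡ r
pred-mod-suc {n₁} {r} lt = begin
  (suc r + n₁) % suc n₁ ≡⟨ cong (_% suc n₁) (sym (+-suc r n₁)) ⟩
  (r + suc n₁) % suc n₁ ≡⟨ [m+n]%n≡m%n r (suc n₁) ⟩
  r % suc n₁            ≡⟨ m<n⇒m%n≡m lt ⟩
  r                     ∎
  where open ≡-Reasoning

cycleStep⇒mod : ∀ {n₁ r s} → s < suc n₁ → CycleStep (suc n₁) r s →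
                s ≡ (r + 1) % suc n₁ ⊎ s ≡ (r + n₁) % suc n₁
cycleStep⇒mod      s<n (inj₁ refl)                     = inj₁ (sym (succ-mod-below s<n))
cycleStep⇒mod      s<n (inj₂ (inj₁ refl))              = inj₂ (sym (pred-mod-suc s<n))
cycleStep⇒mod {n₁} s<n (inj₂ (inj₂ (inj₁ (refl , e)))) =
  inj₂ (trans (suc-injective e) (sym (pred-mod-zero n₁)))
cycleStep⇒mod {n₁} s<n (inj₂ (inj₂ (inj₂ (refl , e)))) =
  inj₁ (sym (trans (cong (λ x → (x + 1) % suc n₁) (suc-injective e)) (succ-mod-top n₁)))

mod⇒cycleStep : ∀ {n₁ r s} → r < suc n₁ → s ≡ (r + 1) % suc n₁ ⊎ s ≡ (r + n₁) % suc n₁ →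
                CycleStep (suc n₁) r s
mod⇒cycleStep {n₁} r<n (inj₁ e) with m<1+n⇒m<n∨m≡n r<n
... | inj₁ r<n₁ = inj₁ (sym (trans e (succ-mod-below (s≤s r<n₁))))
... | inj₂ refl = inj₂ (inj₂ (inj₂ (trans e (succ-mod-top n₁) , refl)))
mod⇒cycleStep {n₁} {zero}  r<n (inj₂ e) =
  inj₂ (inj₂ (inj₁ (refl , cong suc (trans e (pred-mod-zero n₁)))))
mod⇒cycleStep {n₁} {suc r} r<n (inj₂ e) =
  inj₂ (inj₁ (cong suc (trans e (pred-mod-suc (<-trans (n<1+n r) r<n)))))

succ-mod≢pred-mod : ∀ {n₁ r} → 2 ≤ n₁ → r < suc n₁ → (r + 1) % suc n₁ ≢ (r + n₁) % suc n₁
succ-mod≢pred-mod {n₁} {zero} 2≤n₁ _ e =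
  <⇒≢ 2≤n₁ (trans (sym (succ-mod-below (≤-trans 2≤n₁ (n≤1+n n₁)))) (trans e (pred-mod-zero n₁)))
succ-mod≢pred-mod {n₁} {suc r} 2≤n₁ r<n e
  with m<1+n⇒m<n∨m≡n r<n | trans e (pred-mod-suc (<-trans (n<1+n r) r<n))
... | inj₁ r<n₁ | succ-mod≡r = m+1+n≢n 1 (trans (sym (succ-mod-below (s≤s r<n₁))) succ-mod≡r)
... | inj₂ refl | succ-mod≡r = <⇒≢ 2≤n₁ (cong suc (trans (sym (succ-mod-top (suc r))) succ-mod≡r))

weight-C : ∀ {n₁} → 2 ≤ n₁ → ∀ (h : Fin (suc n₁) → ℕ) j →
           weight (C (suc n₁)) h j ≡ h (column (toℕ j + 1)) + h (column (toℕ j + n₁))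
weight-C {n₁} 2≤n₁ h j =
  trans (sum-allFin-select₂ (cycleAdj (suc n₁) j) h
                            (succ-mod≢pred-mod 2≤n₁ (toℕ<n j) ∘ suc-injective) spec)
        (cong₂ _+_ (pad-fromℕ< h _ _) (pad-fromℕ< h _ _))
  where
  suc⇔ : ∀ {a b} → a ≡ b ⇔ suc a ≡ suc b
  suc⇔ = mk⇔ (cong suc) suc-injective

  spec : ∀ y → T (cycleAdj (suc n₁) j y) ⇔
         (suc (toℕ y) ≡ suc ((toℕ j + 1) % suc n₁) ⊎ suc (toℕ y) ≡ suc ((toℕ j + n₁) % suc n₁))
  spec y = (suc⇔ ⊎-⇔ suc⇔)
           ⇔-∘ (mk⇔ (cycleStep⇒mod (toℕ<n y)) (mod⇒cycleStep (toℕ<n j)) ⇔-∘ T-cycleAdj j y)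

-- Distance magic strips

-- L p c labels the vertex (p, c) of a strip, whose neighbours are (p, c ± 1) and (p ± 1, c); magic is
-- the weight condition at (q + 1, c + 1), and rows 0 and m + 1 form a zero border.
record MagicStrip (m k : ℕ) (L : ℕ → ℕ → ℕ) : Set where
  field
    bottom        : ∀ c → L 0 c ≡ 0
    top           : ∀ c → L (suc m) c ≡ 0
    positive      : ∀ q c → q < m → 0 < L (suc q) c
    rows-distinct : ∀ q q′ c c′ → q < m → q′ < m → L (suc q) c ≡ L (suc q′) c′ → q ≡ q′
    magic         : ∀ q c → q < m →
                    (L (suc q) (2 + c) + L (suc q) c) + (L (2 + q) (suc c) + L q (suc c)) ≡ k

module _ {m k : ℕ} {L : ℕ → ℕ → ℕ} (S : MagicStrip m k L) where
  open MagicStrip S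

  antidiagonal : ℕ → ℕ → ℕ
  antidiagonal q c = L (suc q) c + L q (suc c)

  -- The vertices (q + 1, c + 1) and (q + 2, c + 2) have the common neighbours X and Y.
  antidiagonal-step : ∀ q c → 2 + q ≤ m → antidiagonal q c ≡ antidiagonal (2 + q) (2 + c)
  antidiagonal-step q c 2+q≤m = +-cancelˡ-≡ (X + Y) _ _ (begin
    (X + Y) + antidiagonal q c
      ≡⟨ interchange X Y _ _ ⟩
    (X + L (suc q) c) + (Y + L q (suc c))
      ≡⟨ magic q c (≤-trans (n≤1+n (suc q)) 2+q≤m) ⟩
    k
      ≡⟨ sym (magic (suc q) (suc c) 2+q≤m) ⟩
    (L (2 + q) (3 + c) + Y) + (L (3 + q) (2 + c) + X)
      ≡⟨ shuffle (L (2 + q) (3 + c)) (L (3 + q) (2 + c)) X Y ⟩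
    (X + Y) + antidiagonal (2 + q) (2 + c) ∎)
    where
    open ≡-Reasoning
    X Y : ℕ
    X = L (suc q) (2 + c)
    Y = L (2 + q) (suc c)
    shuffle : ∀ a b x y → (a + y) + (b + x) ≡ (x + y) + (b + a)
    shuffle = solve-∀

  antidiagonal-shift : ∀ t q c → q + (t + t) ≤ m →
                       antidiagonal q c ≡ antidiagonal (q + (t + t)) (c + (t + t))
  antidiagonal-shift zero    q c _  = cong₂ antidiagonal (sym (+-identityʳ q)) (sym (+-identityʳ c))
  antidiagonal-shift (suc t) q c le = begin
    antidiagonal q c
      ≡⟨ antidiagonal-step q c (≤-trans (m≤m+n (2 + q) (t + t)) le′) ⟩
    antidiagonal (2 + q) (2 + c)
      ≡⟨ antidiagonal-shift t (2 + q) (2 + c) le′ ⟩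
    antidiagonal (2 + q + (t + t)) (2 + c + (t + t))
      ≡⟨ cong₂ antidiagonal (two-more t q) (two-more t c) ⟩
    antidiagonal (q + (suc t + suc t)) (c + (suc t + suc t)) ∎
    where
    open ≡-Reasoning
    two-more : ∀ s x → 2 + x + (s + s) ≡ x + (suc s + suc s)
    two-more = solve-∀
    le′ : 2 + q + (t + t) ≤ m
    le′ = subst (_≤ m) (sym (two-more t q)) le

  corners-if-even : ∀ t → m ≡ t + t → L 1 0 ≡ L m (suc m)
  corners-if-even t m≡t+t = begin
    L 1 0                        ≡⟨ sym (+-identityʳ _) ⟩
    L 1 0 + 0                    ≡⟨ cong (L 1 0 +_) (sym (bottom 1)) ⟩
    antidiagonal 0 0             ≡⟨ antidiagonal-shift t 0 0 (≤-reflexive (sym m≡t+t)) ⟩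
    antidiagonal (t + t) (t + t) ≡⟨ cong (λ p → antidiagonal p p) (sym m≡t+t) ⟩
    L (suc m) m + L m (suc m)    ≡⟨ cong (_+ L m (suc m)) (top m) ⟩
    L m (suc m)                  ∎
    where open ≡-Reasoning

  corners-if-odd : ∀ t → m ≡ suc (t + t) → L 2 0 + L 1 1 ≤ L 1 1
  corners-if-odd t m≡1+t+t = begin
    L 2 0 + L 1 1                      ≡⟨ antidiagonal-shift t 1 0 (≤-reflexive (sym m≡1+t+t)) ⟩
    L (suc m′) (t + t) + L m′ m′       ≡⟨ cong (_+ L m′ m′) top′ ⟩
    L m′ m′                            ≤⟨ m≤m+n _ _ ⟩
    L m′ m′ + L (t + t) (2 + (t + t))  ≡⟨ sym (antidiagonal-shift t 0 1 t+t≤m) ⟩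
    L 1 1 + L 0 2                      ≡⟨ cong (L 1 1 +_) (bottom 2) ⟩
    L 1 1 + 0                          ≡⟨ +-identityʳ _ ⟩
    L 1 1                              ∎
    where
    open ≤-Reasoning
    m′ : ℕ
    m′ = suc (t + t)
    top′ : L (suc m′) (t + t) ≡ 0
    top′ = subst (λ p → L (suc p) (t + t) ≡ 0) m≡1+t+t (top (t + t))
    t+t≤m : t + t ≤ m
    t+t≤m = ≤-trans (n≤1+n (t + t)) (≤-reflexive (sym m≡1+t+t))

even⊎odd : ∀ m → ∃[ t ] (m ≡ t + t ⊎ m ≡ suc (t + t))
even⊎odd zero    = 0 , inj₁ refl
even⊎odd (suc m) with even⊎odd m
... | t , inj₁ m≡t+t   = t , inj₂ (cong suc m≡t+t)
... | t , inj₂ m≡1+t+t = suc t , inj₁ (cong suc (trans m≡1+t+t (sym (+-suc t t))))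

¬MagicStrip : ∀ {m k L} → 2 ≤ m → ¬ MagicStrip m k L
¬MagicStrip {m} {L = L} 2≤m@(s≤s (s≤s _)) S with even⊎odd m
... | t , inj₁ even = 0≢1+n (rows-distinct 0 _ 0 _ z<s ≤-refl (corners-if-even S t even))
  where open MagicStrip S
... | t , inj₂ odd  = <⇒≱ (positive 1 0 2≤m) (+-cancelʳ-≤ (L 1 1) _ 0 (corners-if-odd S t odd))
  where open MagicStrip S

-- Cylinders

labelOf-injective : ∀ G (f : V G ⤖ Fin (order G)) {u v} → labelOf G f u ≡ labelOf G f v → u ≡ v
labelOf-injective G f e = Bijection.injective f (toℕ-injective (suc-injective e))

column-+ : ∀ {n₁} c d → column {n₁} (toℕ (column {n₁} c) + d) ≡ column (c + d)
column-+ {n₁} c d = fromℕ<-cong _ _ (begin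
  (toℕ (column {n₁} c) + d) % n ≡⟨ cong (λ x → (x + d) % n) (toℕ-fromℕ< (m%n<n c n)) ⟩
  (c % n + d) % n               ≡⟨ %-distribˡ-+ (c % n) d n ⟩
  (c % n % n + d % n) % n       ≡⟨ cong (λ x → (x + d % n) % n) (m%n%n≡m%n c n) ⟩
  (c % n + d % n) % n           ≡⟨ sym (%-distribˡ-+ c d n) ⟩
  (c + d) % n                   ∎) _ _
  where
  open ≡-Reasoning
  n = suc n₁

column-period : ∀ {n₁} c → column {n₁} (c + suc n₁) ≡ column c
column-period {n₁} c = fromℕ<-cong _ _ ([m+n]%n≡m%n c (suc n₁)) _ _

-- Row p ∈ [1, m] of the strip is row p − 1 of the cylinder, and column c is column c mod n.
unroll : ∀ {m n₁} → (Fin m × Fin (suc n₁) → ℕ) → ℕ → ℕ → ℕ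
unroll ℓ p c = pad (λ x → ℓ (x , column c)) p

unroll-magicStrip : ∀ {m n₁ k} → 2 ≤ n₁ →
                    (f : V (P m □ C (suc n₁)) ⤖ Fin (order (P m □ C (suc n₁)))) →
                    (∀ u → weight (P m □ C (suc n₁)) (labelOf (P m □ C (suc n₁)) f) u ≡ k) →
                    MagicStrip m k (unroll (labelOf (P m □ C (suc n₁)) f))
unroll-magicStrip {m} {n₁} {k} 2≤n₁ f wt = record
  { bottom        = λ _ → refl
  ; top           = λ c → pad-beyond (λ x → ℓ (x , column c))
  ; positive      = λ q c q<m → subst (0 <_) (sym (pad-fromℕ< _ q q<m)) z<s
  ; rows-distinct = rows-distinct
  ; magic         = magic
  }
  where
  G = P m □ C (suc n₁)
  ℓ = labelOf G f

  rows-distinct : ∀ q q′ c c′ → q < m → q′ < m → unroll ℓ (suc q) c ≡ unroll ℓ (suc q′) c′ → q ≡ q′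
  rows-distinct q q′ c c′ q<m q′<m e = begin
    q                       ≡⟨ sym (toℕ-fromℕ< q<m) ⟩
    toℕ (fromℕ< q<m)        ≡⟨ cong (toℕ ∘ proj₁) (labelOf-injective G f
                                 (trans (sym (pad-fromℕ< _ q q<m)) (trans e (pad-fromℕ< _ q′ q′<m)))) ⟩
    toℕ (fromℕ< q′<m)       ≡⟨ toℕ-fromℕ< q′<m ⟩
    q′                      ∎
    where open ≡-Reasoning

  magic : ∀ q c → q < m →
          (unroll ℓ (suc q) (2 + c) + unroll ℓ (suc q) c) + (unroll ℓ (2 + q) (suc c) + unroll ℓ q (suc c)) ≡ k
  magic q c q<m = begin
    (unroll ℓ (suc q) (2 + c) + unroll ℓ (suc q) c) + (pad column-j (2 + q) + pad column-j q)
      ≡⟨ cong₂ _+_ (cong₂ _+_ (in-row (2 + c)) (in-row c)) refl ⟩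
    (ℓ (i , column (2 + c)) + ℓ (i , column c)) + (pad column-j (2 + q) + pad column-j q)
      ≡⟨ cong₂ _+_ (cong₂ (λ a b → ℓ (i , a) + ℓ (i , b)) right left)
                   (cong (λ p → pad column-j (2 + p) + pad column-j p) (sym (toℕ-fromℕ< q<m))) ⟩
    (ℓ (i , column (toℕ j + 1)) + ℓ (i , column (toℕ j + n₁))) + (pad column-j (2 + toℕ i) + pad column-j (toℕ i))
      ≡⟨ sym (cong₂ _+_ (weight-C 2≤n₁ _ j) (weight-P _ i)) ⟩
    weight (C (suc n₁)) (λ y → ℓ (i , y)) j + weight (P m) column-j i
      ≡⟨ sym (weight-□ (P m) (C (suc n₁)) selective-allFin selective-allFin (P-loopless m) ℓ i j) ⟩
    weight G ℓ (i , j)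
      ≡⟨ wt (i , j) ⟩
    k ∎
    where
    open ≡-Reasoning
    i = fromℕ< q<m
    j = column (suc c)

    column-j : Fin m → ℕ
    column-j x = ℓ (x , j)

    in-row : ∀ d → unroll ℓ (suc q) d ≡ ℓ (i , column d)
    in-row d = pad-fromℕ< _ q q<m

    right : column (2 + c) ≡ column (toℕ j + 1)
    right = sym (trans (column-+ (suc c) 1) (cong column (+-comm (suc c) 1)))

    left : column c ≡ column (toℕ j + n₁)
    left = sym (begin
      column (toℕ j + n₁)   ≡⟨ column-+ (suc c) n₁ ⟩
      column (suc c + n₁)   ≡⟨ cong column (sym (+-suc c n₁)) ⟩
      column (c + suc n₁)   ≡⟨ column-period c ⟩
      column c              ∎)

theorem3p7 : (m n : ℕ) → m ≥ 2 → n ≥ 3 → NonDistanceMagic (P m □ C n)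
theorem3p7 m (suc n₁) m≥2 (s≤s n₁≥2) (f , k , wt) = ¬MagicStrip m≥2 (unroll-magicStrip n₁≥2 f wt)
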